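{- Let $j, k \in \mathbb{N}^+$ with $k > j$. Then the number of ways to split $2k+j$ balls into nonempty ordered bins (any number of bins) so that at least two bins have exactly $k$ balls is $$F_{2k+j,k,2} = \sum_{\ell=1}^{j} \frac{\ell^2+3\ell+2}{2}\binom{j-1}{\ell-1}.$$
   Context: $F_{2k+j,k,2}$ denotes the number of compositions of $2k+j$ (ordered tuples of positive integers, of any length, summing to $2k+j$) having at least two parts equal to $k$. -}

module Defs where

open import Data.Nat using (ℕ; zero; suc; _+_; _*_; _∸_; _≤_; _<_; _≡ᵇ_)
open import Data.Nat.DivMod using (_/_)
open import Data.Nat.Combinatorics using (_C_)
open import Data.List using (List; []; _∷_; map; concatMap; filterᵇ; length; upTo; applyUpTo)
open import Data.Bool using (Bool)
open import Data.Nat.ListAction using (sum)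

-- Defined by well-founded-free recursion via a fuel argument equal to n.
compsAux : ℕ → ℕ → List (List ℕ)
compsAux zero    zero    = [] ∷ []
compsAux zero    (suc _) = []
compsAux (suc f) zero    = [] ∷ []
compsAux (suc f) (suc n) =
  concatMap (λ i → map (suc i ∷_) (compsAux f (n ∸ i))) (upTo (suc n))

-- all compositions of n (ordered tuples of positive integers summing to n)
compositions : ℕ → List (List ℕ)
compositions n = compsAux n n

countEq : ℕ → List ℕ → ℕ
countEq k c = length (filterᵇ (_≡ᵇ k) c)

F : ℕ → ℕ → ℕ → ℕ
F n k r = length (filterᵇ (λ c → r Data.Nat.≤ᵇ countEq k c) (compositions n))

sumFrom1 : ℕ → (ℕ → ℕ) → ℕ
sumFrom1 j f = sum (applyUpTo (λ i → f (suc i)) j)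

-- Splitting off the first part p of a composition gives F(n,k,r) = Σ_p F(n−p,k,r−[p=k]).
-- For n = rk + j with j < k, a first part p ≠ k with p > j leaves less than rk, too little
-- for r parts equal to k; hence G_r(j) := F(rk+j,k,r) satisfies, for j < k,
--   G_r(j) = Σ_{i<j} G_r(i) + G_{r−1}(j),   G_0(j) = Σ_{i<j} G_0(i) + [j = 0].
-- By Pascal's rule the binomial transform B_g(j) = Σ_ℓ g(ℓ) C(j−1,ℓ−1) satisfies the same
-- recurrence with B_d in place of G_{r−1} whenever g is the sequence of partial sums of d.
-- Such recurrences determine their solution, so G_r = B_w for w(ℓ) = C(ℓ+r,r), and
-- C(ℓ+2,2) = (ℓ²+3ℓ+2)/2.

module Submission where

open import Defs
open import Data.Nat using (ℕ; suc; _+_; _*_; _∸_; _<_; _≡ᵇ_)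
open import Data.Nat.DivMod using (_/_)
open import Data.Nat.Combinatorics using (_C_)
open import Relation.Binary.PropositionalEquality using (_≡_)
open import Data.Nat
open import Data.Nat.Properties
open import Algebra.Properties.CommutativeSemigroup +-commutativeSemigroup using (interchange)
open import Data.Nat.Combinatorics using (nCk+nC[k+1]≡[n+1]C[k+1]; k>n⇒nCk≡0; nCn≡1; nC1≡n)
open import Data.Nat.DivMod using (m*n/n≡m)
open import Data.Nat.Tactic.RingSolver using (solve-∀)
open import Data.Nat.ListAction using (sum)
open import Data.Bool using (Bool; true; false; if_then_else_; T)
open import Data.Bool.Properties using (T?)
open import Data.List using (List; []; _∷_; _++_; map; concat; concatMap; filterᵇ; length; upTo; applyUpTo)
open import Data.List.Properties using (length-++; filter-++; filter-none; concatMap-cong; map-upTo; map-applyUpTo)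
open import Data.List.Relation.Unary.All as All using (All; []; _∷_)
open import Data.List.Relation.Unary.All.Properties using (concat⁺; map⁺; applyUpTo⁺₁)
open import Data.Sum using (inj₁; inj₂)
open import Data.Unit using (tt)
open import Data.Empty using (⊥-elim)
open import Function using (_∘_)
open import Relation.Binary.PropositionalEquality
open import Relation.Nullary using (contradiction)

∑< : ℕ → (ℕ → ℕ) → ℕ
∑< n f = sum (applyUpTo f n)

-- ∑[ i < n ] a * b + c reads (Σ_{i<n} a·b) + c; the summand must be parenthesised when it
-- contains _C_, which has the same precedence.
infix 6.5 ∑<
syntax ∑< n (λ i → e) = ∑[ i < n ] e

∑-cong : ∀ n {f g : ℕ → ℕ} → (∀ i → i < n → f i ≡ g i) → ∑< n f ≡ ∑< n g
∑-cong zero    f≡g = refl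
∑-cong (suc n) f≡g = cong₂ _+_ (f≡g 0 z<s) (∑-cong n (λ i i<n → f≡g (suc i) (s<s i<n)))

∑-zero : ∀ n {f : ℕ → ℕ} → (∀ i → i < n → f i ≡ 0) → ∑< n f ≡ 0
∑-zero zero    f≡0 = refl
∑-zero (suc n) f≡0 = cong₂ _+_ (f≡0 0 z<s) (∑-zero n (λ i i<n → f≡0 (suc i) (s<s i<n)))

∑-+ : ∀ n (f g : ℕ → ℕ) → ∑[ i < n ] (f i + g i) ≡ ∑< n f + ∑< n g
∑-+ zero    f g = refl
∑-+ (suc n) f g = trans (cong (f 0 + g 0 +_) (∑-+ n (f ∘ suc) (g ∘ suc)))
                        (interchange (f 0) (g 0) _ _)

∑-split : ∀ m n (f : ℕ → ℕ) → ∑< (m + n) f ≡ ∑< m f + ∑[ i < n ] f (m + i)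
∑-split zero    n f = refl
∑-split (suc m) n f = trans (cong (f 0 +_) (∑-split m n (f ∘ suc))) (sym (+-assoc (f 0) _ _))

∑-last : ∀ n (f : ℕ → ℕ) → ∑< (suc n) f ≡ ∑< n f + f n
∑-last zero    f = +-comm (f 0) 0
∑-last (suc n) f = trans (cong (f 0 +_) (∑-last n (f ∘ suc))) (sym (+-assoc (f 0) _ _))

∑-reverse : ∀ n (f : ℕ → ℕ) → ∑[ i < n ] f (n ∸ suc i) ≡ ∑< n f
∑-reverse zero    f = refl
∑-reverse (suc n) f = begin
  f n + ∑[ i < n ] f (n ∸ suc i)  ≡⟨ cong (f n +_) (∑-reverse n f) ⟩
  f n + ∑< n f                    ≡⟨ +-comm (f n) _ ⟩
  ∑< n f + f n                    ≡⟨ ∑-last n f ⟨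
  ∑< (suc n) f                    ∎
  where open ≡-Reasoning

∑-single : ∀ n t (f : ℕ → ℕ) → t < n → (∀ i → i < n → i ≢ t → f i ≡ 0) → ∑< n f ≡ f t
∑-single (suc n) zero    f _         others =
  trans (cong (f 0 +_) (∑-zero n (λ i i<n → others (suc i) (s<s i<n) λ ()))) (+-identityʳ (f 0))
∑-single (suc n) (suc t) f (s<s t<n) others =
  trans (cong (_+ ∑< n (f ∘ suc)) (others 0 z<s λ ()))
        (∑-single n t (f ∘ suc) t<n (λ i i<n i≢t → others (suc i) (s<s i<n) (i≢t ∘ suc-injective)))

-- binomialSum g j = Σ_{ℓ=1}^{j} g ℓ · C(j−1, ℓ−1); the value g 0 at j = 0 is chosen so that
-- binomialSum-partialSums also holds at j = 0.
binomialSum : (ℕ → ℕ) → ℕ → ℕ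
binomialSum g zero    = g 0
binomialSum g (suc m) = ∑[ i < suc m ] g (suc i) * (m C i)

binomialSum-cong : ∀ {g h : ℕ → ℕ} → (∀ x → g x ≡ h x) → ∀ j → binomialSum g j ≡ binomialSum h j
binomialSum-cong g≡h zero    = g≡h 0
binomialSum-cong g≡h (suc m) = ∑-cong (suc m) (λ i _ → cong (_* (m C i)) (g≡h (suc i)))

binomialSum-+ : ∀ (g h : ℕ → ℕ) j → binomialSum (λ x → g x + h x) j ≡ binomialSum g j + binomialSum h j
binomialSum-+ g h zero    = refl
binomialSum-+ g h (suc m) =
  trans (∑-cong (suc m) (λ i _ → *-distribʳ-+ (m C i) (g (suc i)) (h (suc i))))
        (∑-+ (suc m) (λ i → g (suc i) * (m C i)) (λ i → h (suc i) * (m C i)))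

binomialSum-pascal : ∀ g m → binomialSum g (suc (suc m)) ≡ binomialSum g (suc m) + binomialSum (g ∘ suc) (suc m)
binomialSum-pascal g m = begin
  g 1 * 1 + ∑[ i < suc m ] g (2 + i) * (suc m C suc i)
    ≡⟨ cong (g 1 * 1 +_) (∑-cong (suc m) λ i _ → pascalTerm i) ⟩
  g 1 * 1 + ∑[ i < suc m ] (g (2 + i) * (m C suc i) + g (2 + i) * (m C i))
    ≡⟨ cong (g 1 * 1 +_) (∑-+ (suc m) (λ i → g (2 + i) * (m C suc i)) (λ i → g (2 + i) * (m C i))) ⟩
  g 1 * 1 + (∑[ i < suc m ] g (2 + i) * (m C suc i) + binomialSum (g ∘ suc) (suc m))
    ≡⟨ cong (λ s → g 1 * 1 + (s + binomialSum (g ∘ suc) (suc m))) dropLast ⟩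
  g 1 * 1 + (∑[ i < m ] g (2 + i) * (m C suc i) + binomialSum (g ∘ suc) (suc m))
    ≡⟨ +-assoc (g 1 * 1) _ _ ⟨
  binomialSum g (suc m) + binomialSum (g ∘ suc) (suc m)
    ∎
  where
  open ≡-Reasoning
  pascalTerm : ∀ i → g (2 + i) * (suc m C suc i) ≡ g (2 + i) * (m C suc i) + g (2 + i) * (m C i)
  pascalTerm i = begin
    g (2 + i) * (suc m C suc i)              ≡⟨ cong (g (2 + i) *_) (nCk+nC[k+1]≡[n+1]C[k+1] m i) ⟨
    g (2 + i) * (m C i + m C suc i)          ≡⟨ cong (g (2 + i) *_) (+-comm (m C i) _) ⟩
    g (2 + i) * (m C suc i + m C i)          ≡⟨ *-distribˡ-+ (g (2 + i)) _ _ ⟩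
    g (2 + i) * (m C suc i) + g (2 + i) * (m C i) ∎
  dropLast : ∑[ i < suc m ] g (2 + i) * (m C suc i) ≡ ∑[ i < m ] g (2 + i) * (m C suc i)
  dropLast = begin
    ∑[ i < suc m ] g (2 + i) * (m C suc i)            ≡⟨ ∑-last m (λ i → g (2 + i) * (m C suc i)) ⟩
    ∑[ i < m ] g (2 + i) * (m C suc i) + g (2 + m) * (m C suc m)
        ≡⟨ cong (λ c → ∑[ i < m ] g (2 + i) * (m C suc i) + g (2 + m) * c) (k>n⇒nCk≡0 (n<1+n m)) ⟩
    ∑[ i < m ] g (2 + i) * (m C suc i) + g (2 + m) * 0
      ≡⟨ cong (∑[ i < m ] g (2 + i) * (m C suc i) +_) (*-zeroʳ (g (2 + m))) ⟩
    ∑[ i < m ] g (2 + i) * (m C suc i) + 0            ≡⟨ +-identityʳ _ ⟩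
    ∑[ i < m ] g (2 + i) * (m C suc i)                ∎

binomialSum-suc : ∀ g j → binomialSum g (suc j) ≡ ∑[ i < suc j ] binomialSum (g ∘ suc) i
binomialSum-suc g zero    = cong (_+ 0) (*-identityʳ (g 1))
binomialSum-suc g (suc m) = begin
  binomialSum g (suc (suc m))                                           ≡⟨ binomialSum-pascal g m ⟩
  binomialSum g (suc m) + binomialSum (g ∘ suc) (suc m)                 ≡⟨ cong (_+ binomialSum (g ∘ suc) (suc m)) (binomialSum-suc g m) ⟩
  ∑[ i < suc m ] binomialSum (g ∘ suc) i + binomialSum (g ∘ suc) (suc m) ≡⟨ ∑-last (suc m) (binomialSum (g ∘ suc)) ⟨
  ∑[ i < suc (suc m) ] binomialSum (g ∘ suc) i                          ∎
  where open ≡-Reasoning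

binomialSum-partialSums : ∀ (g d : ℕ → ℕ) → g 0 ≡ d 0 → (∀ x → g (suc x) ≡ g x + d (suc x)) →
  ∀ j → binomialSum g j ≡ ∑[ i < j ] binomialSum g i + binomialSum d j
binomialSum-partialSums g d g0≡d0 g-suc zero    = g0≡d0
binomialSum-partialSums g d g0≡d0 g-suc (suc m) = begin
  binomialSum g (suc m)                                                    ≡⟨ binomialSum-suc g m ⟩
  ∑[ i < suc m ] binomialSum (g ∘ suc) i                                   ≡⟨ ∑-cong (suc m) (λ i _ → binomialSum-cong g-suc i) ⟩
  ∑[ i < suc m ] binomialSum (λ x → g x + d (suc x)) i                      ≡⟨ ∑-cong (suc m) (λ i _ → binomialSum-+ g (d ∘ suc) i) ⟩
  ∑[ i < suc m ] (binomialSum g i + binomialSum (d ∘ suc) i)                ≡⟨ ∑-+ (suc m) (binomialSum g) (binomialSum (d ∘ suc)) ⟩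
  ∑[ i < suc m ] binomialSum g i + ∑[ i < suc m ] binomialSum (d ∘ suc) i   ≡⟨ cong (∑[ i < suc m ] binomialSum g i +_) (binomialSum-suc d m) ⟨
  ∑[ i < suc m ] binomialSum g i + binomialSum d (suc m)                    ∎
  where open ≡-Reasoning

partialSumRecurrence-unique : ∀ k (X Y U : ℕ → ℕ) →
  (∀ j → j < k → X j ≡ ∑[ i < j ] X i + U j) →
  (∀ j → j < k → Y j ≡ ∑[ i < j ] Y i + U j) →
  ∀ j → j < k → X j ≡ Y j
partialSumRecurrence-unique k X Y U X-rec Y-rec j j<k = agreeBelow (suc j) j<k j ≤-refl
  where
  agreeBelow : ∀ n → n ≤ k → ∀ i → i < n → X i ≡ Y i
  agreeBelow (suc n) n<k i i<1+n with m≤n⇒m<n∨m≡n (s≤s⁻¹ i<1+n)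
  ... | inj₁ i<n  = agreeBelow n (<⇒≤ n<k) i i<n
  ... | inj₂ refl = begin
    X i                   ≡⟨ X-rec i n<k ⟩
    ∑[ l < i ] X l + U i  ≡⟨ cong (_+ U i) (∑-cong i (agreeBelow i (<⇒≤ n<k))) ⟩
    ∑[ l < i ] Y l + U i  ≡⟨ Y-rec i n<k ⟨
    Y i                   ∎
    where open ≡-Reasoning

length-filterᵇ-concat : ∀ {A : Set} (p : A → Bool) (xss : List (List A)) →
  length (filterᵇ p (concat xss)) ≡ sum (map (length ∘ filterᵇ p) xss)
length-filterᵇ-concat p []         = refl
length-filterᵇ-concat p (xs ∷ xss) = begin
  length (filterᵇ p (xs ++ concat xss))                ≡⟨ cong length (filter-++ (T? ∘ p) xs (concat xss)) ⟩
  length (filterᵇ p xs ++ filterᵇ p (concat xss))      ≡⟨ length-++ (filterᵇ p xs) ⟩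
  length (filterᵇ p xs) + length (filterᵇ p (concat xss)) ≡⟨ cong (length (filterᵇ p xs) +_) (length-filterᵇ-concat p xss) ⟩
  length (filterᵇ p xs) + sum (map (length ∘ filterᵇ p) xss) ∎
  where open ≡-Reasoning

length-filterᵇ-map : ∀ {A B : Set} (p : B → Bool) (q : A → Bool) (f : A → B) → (∀ x → p (f x) ≡ q x) →
  ∀ xs → length (filterᵇ p (map f xs)) ≡ length (filterᵇ q xs)
length-filterᵇ-map p q f pf≡q []       = refl
length-filterᵇ-map p q f pf≡q (x ∷ xs) rewrite pf≡q x with q x
... | true  = cong suc (length-filterᵇ-map p q f pf≡q xs)
... | false = length-filterᵇ-map p q f pf≡q xs

compsAux-fuel : ∀ {f g} n → n ≤ f → n ≤ g → compsAux f n ≡ compsAux g n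
compsAux-fuel {zero}  {zero}  zero _ _ = refl
compsAux-fuel {zero}  {suc _} zero _ _ = refl
compsAux-fuel {suc _} {zero}  zero _ _ = refl
compsAux-fuel {suc _} {suc _} zero _ _ = refl
compsAux-fuel {suc f} {suc g} (suc n) (s≤s n≤f) (s≤s n≤g) =
  concatMap-cong (λ i → cong (map (suc i ∷_))
    (compsAux-fuel (n ∸ i) (≤-trans (m∸n≤m n i) n≤f) (≤-trans (m∸n≤m n i) n≤g))) (upTo (suc n))

compositions-suc : ∀ n →
  compositions (suc n) ≡ concatMap (λ i → map (suc i ∷_) (compositions (n ∸ i))) (upTo (suc n))
compositions-suc n = concatMap-cong (λ i → cong (map (suc i ∷_)) (compsAux-fuel (n ∸ i) (m∸n≤m n i) ≤-refl)) (upTo (suc n))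

sum-compsAux : ∀ f n → All (λ c → sum c ≡ n) (compsAux f n)
sum-compsAux zero    zero    = refl ∷ []
sum-compsAux zero    (suc n) = []
sum-compsAux (suc f) zero    = refl ∷ []
sum-compsAux (suc f) (suc n) = concat⁺ (map⁺ (applyUpTo⁺₁ (λ i → i) (suc n) λ {i} i<1+n →
  map⁺ (All.map (λ sum≡n∸i → trans (cong (suc i +_) sum≡n∸i) (cong suc (m+[n∸m]≡n (s≤s⁻¹ i<1+n)))) (sum-compsAux f (n ∸ i)))))

countEq-∷ : ∀ k p c → countEq k (p ∷ c) ≡ (if p ≡ᵇ k then suc (countEq k c) else countEq k c)
countEq-∷ k p c with p ≡ᵇ k
... | true  = refl
... | false = refl

countEq*k≤sum : ∀ k c → countEq k c * k ≤ sum c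
countEq*k≤sum k []      = z≤n
countEq*k≤sum k (p ∷ c) rewrite countEq-∷ k p c with p ≡ᵇ k in p≡ᵇk
... | true  rewrite ≡ᵇ⇒≡ p k (subst T (sym p≡ᵇk) tt) = +-monoʳ-≤ k (countEq*k≤sum k c)
... | false = ≤-trans (countEq*k≤sum k c) (m≤n+m (sum c) p)

stillNeeded : ℕ → ℕ → ℕ → ℕ
stillNeeded k p r = if p ≡ᵇ k then r ∸ 1 else r

atLeast-∷ : ∀ k r p c → (r ≤ᵇ countEq k (p ∷ c)) ≡ (stillNeeded k p r ≤ᵇ countEq k c)
atLeast-∷ k r p c rewrite countEq-∷ k p c with p ≡ᵇ k
atLeast-∷ k zero          p c | true  = refl
atLeast-∷ k (suc zero)    p c | true  = refl
atLeast-∷ k (suc (suc r)) p c | true  = refl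
... | false = refl

stillNeeded-≢ : ∀ k p r → p ≢ k → stillNeeded k p r ≡ r
stillNeeded-≢ k p r p≢k with p ≡ᵇ k in p≡ᵇk
... | true  = contradiction (≡ᵇ⇒≡ p k (subst T (sym p≡ᵇk) tt)) p≢k
... | false = refl

stillNeeded-≡ : ∀ k r → stillNeeded k k r ≡ r ∸ 1
stillNeeded-≡ k r with k ≡ᵇ k in k≡ᵇk
... | true  = refl
... | false = ⊥-elim (subst T k≡ᵇk (≡⇒≡ᵇ k k refl))

stillNeeded-0 : ∀ k p → stillNeeded k p 0 ≡ 0
stillNeeded-0 k p with p ≡ᵇ k
... | true  = refl
... | false = refl

F-firstPart : ∀ n k r → F (suc n) k r ≡ ∑[ i < suc n ] F (n ∸ i) k (stillNeeded k (suc i) r)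
F-firstPart n k r = begin
  length (filterᵇ (atLeast r) (compositions (suc n)))
    ≡⟨ cong (length ∘ filterᵇ (atLeast r)) (compositions-suc n) ⟩
  length (filterᵇ (atLeast r) (concat (map byFirstPart (upTo (suc n)))))
    ≡⟨ length-filterᵇ-concat (atLeast r) (map byFirstPart (upTo (suc n))) ⟩
  sum (map (length ∘ filterᵇ (atLeast r)) (map byFirstPart (upTo (suc n))))
    ≡⟨ cong (sum ∘ map (length ∘ filterᵇ (atLeast r))) (map-upTo byFirstPart (suc n)) ⟩
  sum (map (length ∘ filterᵇ (atLeast r)) (applyUpTo byFirstPart (suc n)))
    ≡⟨ cong sum (map-applyUpTo byFirstPart (length ∘ filterᵇ (atLeast r)) (suc n)) ⟩
  ∑[ i < suc n ] length (filterᵇ (atLeast r) (byFirstPart i))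
    ≡⟨ ∑-cong (suc n) (λ i _ → length-filterᵇ-map (atLeast r) (atLeast (stillNeeded k (suc i) r)) (suc i ∷_)
                                 (atLeast-∷ k r (suc i)) (compositions (n ∸ i))) ⟩
  ∑[ i < suc n ] F (n ∸ i) k (stillNeeded k (suc i) r)
    ∎
  where
  open ≡-Reasoning
  atLeast : ℕ → List ℕ → Bool
  atLeast r c = r ≤ᵇ countEq k c
  byFirstPart : ℕ → List (List ℕ)
  byFirstPart i = map (suc i ∷_) (compositions (n ∸ i))

F-vanish : ∀ n k r → n < r * k → F n k r ≡ 0
F-vanish n k r n<r*k = cong length (filter-none (T? ∘ λ c → r ≤ᵇ countEq k c)
  (All.map (λ {c} sum≡n r≤ᵇcount → <⇒≱ (fewerThan c sum≡n) (≤ᵇ⇒≤ r (countEq k c) r≤ᵇcount))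
           (sum-compsAux n n)))
  where
  fewerThan : ∀ c → sum c ≡ n → countEq k c < r
  fewerThan c sum≡n = *-cancelʳ-< k _ _ (≤-<-trans (≤-trans (countEq*k≤sum k c) (≤-reflexive sum≡n)) n<r*k)

δ₀ : ℕ → ℕ
δ₀ zero    = 1
δ₀ (suc _) = 0

F-atLeast0 : ∀ k j → F j k 0 ≡ ∑[ i < j ] F i k 0 + δ₀ j
F-atLeast0 k zero    = refl
F-atLeast0 k (suc n) = begin
  F (suc n) k 0                                          ≡⟨ F-firstPart n k 0 ⟩
  ∑[ i < suc n ] F (n ∸ i) k (stillNeeded k (suc i) 0)   ≡⟨ ∑-cong (suc n) (λ i _ → cong (F (n ∸ i) k) (stillNeeded-0 k (suc i))) ⟩
  ∑[ i < suc n ] F (suc n ∸ suc i) k 0                   ≡⟨ ∑-reverse (suc n) (λ i → F i k 0) ⟩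
  ∑[ i < suc n ] F i k 0                                 ≡⟨ +-identityʳ _ ⟨
  ∑[ i < suc n ] F i k 0 + 0                             ∎
  where open ≡-Reasoning

F-layer : ∀ k r j → j < k →
  F (suc r * k + j) k (suc r) ≡ ∑[ i < j ] F (suc r * k + i) k (suc r) + F (r * k + j) k r
F-layer k@(suc k₀) r j (s≤s j≤k₀) = begin
  F (suc (a + j)) k (suc r)                        ≡⟨ F-firstPart (a + j) k (suc r) ⟩
  ∑[ i < suc (a + j) ] term i                      ≡⟨ cong (λ m → ∑< m term) (+-comm (suc a) j) ⟩
  ∑[ i < j + suc a ] term i                        ≡⟨ ∑-split j (suc a) term ⟩
  ∑[ i < j ] term i + ∑[ i < suc a ] term (j + i)  ≡⟨ cong₂ _+_ shortFirstParts longFirstParts ⟩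
  ∑[ i < j ] F (suc a + i) k (suc r) + F (r * k + j) k r ∎
  where
  open ≡-Reasoning
  -- suc r * k reduces to suc a
  a = k₀ + r * k
  term : ℕ → ℕ
  term i = F (a + j ∸ i) k (stillNeeded k (suc i) (suc r))
  shortFirstParts : ∑[ i < j ] term i ≡ ∑[ i < j ] F (suc a + i) k (suc r)
  shortFirstParts = trans
    (∑-cong j λ i i<j → cong₂ (λ n → F n k) (+-∸-assoc (suc a) i<j)
                                             (stillNeeded-≢ k (suc i) (suc r) (<⇒≢ (s≤s (<-≤-trans i<j j≤k₀)))))
    (∑-reverse j (λ i → F (suc a + i) k (suc r)))
  t = k₀ ∸ j
  j+t≡k₀ : j + t ≡ k₀
  j+t≡k₀ = m+[n∸m]≡n j≤k₀
  partK : term (j + t) ≡ F (r * k + j) k r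
  partK rewrite j+t≡k₀ =
    cong₂ (λ n → F n k) (trans (cong (_∸ k₀) (+-assoc k₀ (r * k) j)) (m+n∸m≡n k₀ (r * k + j)))
                        (stillNeeded-≡ k (suc r))
  otherParts : ∀ i → i < suc a → i ≢ t → term (j + i) ≡ 0
  otherParts i _ i≢t = trans (cong (F (a + j ∸ (j + i)) k) (stillNeeded-≢ k (suc (j + i)) (suc r) notK))
                             (F-vanish (a + j ∸ (j + i)) k (suc r) (s≤s tooShort))
    where
    notK : suc (j + i) ≢ k
    notK 1+j+i≡k = i≢t (trans (sym (m+n∸m≡n j i)) (cong (_∸ j) (suc-injective 1+j+i≡k)))
    tooShort : a + j ∸ (j + i) ≤ a
    tooShort = ≤-trans (∸-monoʳ-≤ (a + j) (m≤m+n j i)) (≤-reflexive (m+n∸n≡m a j))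
  longFirstParts : ∑[ i < suc a ] term (j + i) ≡ F (r * k + j) k r
  longFirstParts = trans (∑-single (suc a) t (term ∘ (j +_)) t<1+a otherParts) partK
    where
    t<1+a : t < suc a
    t<1+a = s≤s (≤-trans (m∸n≤m k₀ j) (m≤m+n k₀ (r * k)))

binomialSum-δ₀ : ∀ j → binomialSum δ₀ j ≡ δ₀ j
binomialSum-δ₀ zero    = refl
binomialSum-δ₀ (suc m) = ∑-zero (suc m) (λ _ _ → refl)

[ℓ+1+r]C[1+r] : ∀ r ℓ → (suc ℓ + suc r) C suc r ≡ (ℓ + suc r) C suc r + (suc ℓ + r) C r
[ℓ+1+r]C[1+r] r ℓ = begin
  suc (ℓ + suc r) C suc r                  ≡⟨ nCk+nC[k+1]≡[n+1]C[k+1] (ℓ + suc r) r ⟨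
  (ℓ + suc r) C r + (ℓ + suc r) C suc r    ≡⟨ +-comm ((ℓ + suc r) C r) _ ⟩
  (ℓ + suc r) C suc r + (ℓ + suc r) C r    ≡⟨ cong (λ n → (ℓ + suc r) C suc r + n C r) (+-suc ℓ r) ⟩
  (ℓ + suc r) C suc r + (suc ℓ + r) C r    ∎
  where open ≡-Reasoning

-- (ℓ + 0) C 0 computes to 1, the partial sums of δ₀, whence the two refl's.
F-closedForm : ∀ k r j → j < k → F (r * k + j) k r ≡ binomialSum (λ ℓ → (ℓ + r) C r) j
F-closedForm k zero = partialSumRecurrence-unique k (λ j → F j k 0) (binomialSum one) δ₀
  (λ j _ → F-atLeast0 k j)
  (λ j _ → trans (binomialSum-partialSums one δ₀ refl (λ _ → refl) j)
                 (cong (∑< j (binomialSum one) +_) (binomialSum-δ₀ j)))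
  where
  one : ℕ → ℕ
  one ℓ = (ℓ + 0) C 0
F-closedForm k (suc r) = partialSumRecurrence-unique k
  (λ j → F (suc r * k + j) k (suc r)) (binomialSum (λ ℓ → (ℓ + suc r) C suc r)) (binomialSum (λ ℓ → (ℓ + r) C r))
  (λ j j<k → trans (F-layer k r j j<k) (cong (∑[ i < j ] F (suc r * k + i) k (suc r) +_) (F-closedForm k r j j<k)))
  (λ j _ → binomialSum-partialSums _ _ (trans (nCn≡1 (suc r)) (sym (nCn≡1 r))) ([ℓ+1+r]C[1+r] r) j)

[ℓ+2]C2*2 : ∀ ℓ → ((ℓ + 2) C 2) * 2 ≡ ℓ * ℓ + 3 * ℓ + 2
[ℓ+2]C2*2 zero    = cong (_* 2) (nCn≡1 2)
[ℓ+2]C2*2 (suc ℓ) = begin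
  (suc (ℓ + 2) C 2) * 2                 ≡⟨ cong (_* 2) (nCk+nC[k+1]≡[n+1]C[k+1] (ℓ + 2) 1) ⟨
  ((ℓ + 2) C 1 + (ℓ + 2) C 2) * 2       ≡⟨ cong (λ c → (c + (ℓ + 2) C 2) * 2) (nC1≡n (ℓ + 2)) ⟩
  (ℓ + 2 + (ℓ + 2) C 2) * 2             ≡⟨ *-distribʳ-+ 2 (ℓ + 2) _ ⟩
  (ℓ + 2) * 2 + ((ℓ + 2) C 2) * 2       ≡⟨ cong ((ℓ + 2) * 2 +_) ([ℓ+2]C2*2 ℓ) ⟩
  (ℓ + 2) * 2 + (ℓ * ℓ + 3 * ℓ + 2)     ≡⟨ expand ℓ ⟩
  suc ℓ * suc ℓ + 3 * suc ℓ + 2         ∎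
  where
  open ≡-Reasoning
  expand : ∀ ℓ → (ℓ + 2) * 2 + (ℓ * ℓ + 3 * ℓ + 2) ≡ suc ℓ * suc ℓ + 3 * suc ℓ + 2
  expand = solve-∀

[ℓ+2]C2 : ∀ ℓ → (ℓ + 2) C 2 ≡ (ℓ * ℓ + 3 * ℓ + 2) / 2
[ℓ+2]C2 ℓ = trans (sym (m*n/n≡m ((ℓ + 2) C 2) 2)) (cong (_/ 2) ([ℓ+2]C2*2 ℓ))

mainTheorem8 : (j k : ℕ) → 1 Data.Nat.≤ j → j < k →
    F (2 * k + j) k 2 ≡ sumFrom1 j (λ ℓ → ((ℓ * ℓ + 3 * ℓ + 2) / 2) * ((j ∸ 1) C (ℓ ∸ 1)))
mainTheorem8 (suc m) k _ j<k = begin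
  F (2 * k + suc m) k 2                       ≡⟨ F-closedForm k 2 (suc m) j<k ⟩
  ∑[ i < suc m ] ((suc i + 2) C 2) * (m C i)  ≡⟨ ∑-cong (suc m) (λ i _ → cong (_* (m C i)) ([ℓ+2]C2 (suc i))) ⟩
  ∑[ i < suc m ] ((suc i * suc i + 3 * suc i + 2) / 2) * (m C i) ∎
  where open ≡-Reasoning
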